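{- Let $f(x,y,z)=\dfrac{(1-x-2y)^{2/3}}{1-x-y-z}$, viewed as a power series in $\mathbb{Q}[[x,y,z]]$ (branch equal to $1$ at the origin). Then $$\mathrm{Diag}(f)(x)\;=\;{}_3F_2\Bigl(\bigl[\tfrac{1}{9},\tfrac{4}{9},\tfrac{7}{9}\bigr],\bigl[\tfrac{2}{3},1\bigr];\,27x\Bigr).$$
   Context: For a power series $F(x_1,\dots,x_n)=\sum R_{m_1,\dots,m_n}x_1^{m_1}\cdots x_n^{m_n}$, its diagonal is $\mathrm{Diag}(F)(x)=\sum_{m\ge0}R_{m,\dots,m}x^m$. The generalized hypergeometric series is ${}_pF_{p-1}([a_1,\dots,a_p],[b_1,\dots,b_{p-1}];x)=\sum_{n\ge0}\frac{(a_1)_n\cdots(a_p)_n}{(b_1)_n\cdots(b_{p-1})_n}\frac{x^n}{n!}$, with $(c)_n=c(c+1)\cdots(c+n-1)$. -}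

module Defs where

open import Data.Nat as ℕ using (ℕ; zero; suc; _∸_)
open import Data.Integer using (ℤ; +_; -[1+_])
open import Data.Rational using (ℚ; 0ℚ; 1ℚ; _+_; _*_; _-_; -_; 1/_; _/_; ≢-nonZero)
open import Data.Rational.Properties using (_≟_)
open import Data.List using (List; []; _∷_)
open import Relation.Nullary using (yes; no)

sumTo : ℕ → (ℕ → ℚ) → ℚ
sumTo zero    h = h 0
sumTo (suc n) h = sumTo n h + h (suc n)

-- total reciprocal on ℚ (inv 0 = 0); only applied to nonzero values below
inv : ℚ → ℚ
inv q with q ≟ 0ℚ
... | yes _  = 0ℚ
... | no q≢0 = 1/_ q {{≢-nonZero q≢0}}

fromℕ : ℕ → ℚ
fromℕ n = (+ n) / 1

_^_ : ℚ → ℕ → ℚ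
q ^ zero  = 1ℚ
q ^ suc n = q * (q ^ n)

-- Formal power series in ℚ[[x,y,z]]: coefficient of x^a y^b z^c
PS3 : Set
PS3 = ℕ → ℕ → ℕ → ℚ

constPS : ℚ → PS3
constPS q zero zero zero = q
constPS q _    _    _    = 0ℚ

linPS : ℚ → ℚ → ℚ → PS3
linPS α β γ 1 0 0 = α
linPS α β γ 0 1 0 = β
linPS α β γ 0 0 1 = γ
linPS α β γ _ _ _ = 0ℚ

_⊛_ : PS3 → PS3 → PS3
(f ⊛ g) a b c =
  sumTo a λ i → sumTo b λ j → sumTo c λ k →
    f i j k * g (a ∸ i) (b ∸ j) (c ∸ k)

powPS : PS3 → ℕ → PS3
powPS u zero    = constPS 1ℚ
powPS u (suc k) = u ⊛ powPS u k

fallingQ : ℚ → ℕ → ℚ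
fallingQ α zero    = 1ℚ
fallingQ α (suc k) = fallingQ α k * (α - fromℕ k)

factQ : ℕ → ℚ
factQ zero    = 1ℚ
factQ (suc k) = fromℕ (suc k) * factQ k

binomQ : ℚ → ℕ → ℚ
binomQ α k = fallingQ α k * inv (factQ k)

-- (1 + u)^α := Σ_k binom(α,k) u^k, for u with zero constant term
-- (the branch equal to 1 at the origin).  Since u^k has no monomials
-- of total degree < k, the coefficient of x^a y^b z^c only involves
-- k ≤ a + b + c, so the sum below is the full (finite) sum.
binomSeries : ℚ → PS3 → PS3
binomSeries α u a b c =
  sumTo (a ℕ.+ b ℕ.+ c) λ k → binomQ α k * powPS u k a b c

-- 1/(1 - v) := Σ_k v^k, for v with zero constant term
geomSeries : PS3 → PS3
geomSeries v a b c = sumTo (a ℕ.+ b ℕ.+ c) λ k → powPS v k a b c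

fSeries : PS3
fSeries =
  binomSeries ((+ 2) / 3) (linPS (- 1ℚ) (- fromℕ 2) 0ℚ)
  ⊛ geomSeries (linPS 1ℚ 1ℚ 1ℚ)

Diag : PS3 → ℕ → ℚ
Diag F m = F m m m

poch : ℚ → ℕ → ℚ
poch c zero    = 1ℚ
poch c (suc n) = poch c n * (c + fromℕ n)

prodPoch : List ℚ → ℕ → ℚ
prodPoch []       n = 1ℚ
prodPoch (c ∷ cs) n = poch c n * prodPoch cs n

-- coefficient of x^n in  pFq(as, bs; t·x)
--   = (a_1)_n…(a_p)_n / ((b_1)_n…(b_q)_n n!) · t^n
hypergeomCoeff : List ℚ → List ℚ → ℚ → ℕ → ℚ
hypergeomCoeff as bs t n =
  prodPoch as n * inv (prodPoch bs n * factQ n) * (t ^ n)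

module Submission where

-- Since the numerator has no z, [x^m y^m z^m] f = Σ_{i,j ≤ m} a_{ij} b_{m−i,m−j,m},
-- where by the multinomial theorem a_{ij} = (−2/3)_{i+j} 2^j / (i! j!) and
-- b_{pqr} = (p+q+r)! / (p! q! r!).  With k = m − j each term splits into a
-- factor depending on (j, k) and a Chu–Vandermonde term in i; the sum over i
-- is (1/3 + 2m)_m / m!.  The remaining sum E_m = Σ_j (−2/3)_j 2^j (2m−j)! / (j! (m−j)!)
-- satisfies (2/3)_m E_m = (1/3)_{2m}.  Both sums are evaluated by creative
-- telescoping: a certificate turns the sum into a first-order recurrence in m,
-- which is then solved.  Finally (1/3)_{2m} (1/3 + 2m)_m = (1/3)_{3m}
-- = 27^m (1/9)_m (4/9)_m (7/9)_m by the triplication formula.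

open import Defs
open import Data.Nat as ℕ using (ℕ; zero; suc; _∸_; _≤_)
import Data.Nat.Properties as ℕₚ
import Data.Nat.Tactic.RingSolver as ℕ-Solver
open import Data.Integer as ℤ using (+_)
import Data.Integer.Properties as ℤₚ
open import Data.Rational using (ℚ; 0ℚ; 1ℚ; _+_; _*_; _-_; -_; _/_; toℚᵘ; Positive)
open import Data.Rational.Properties
import Data.Rational.Unnormalised as ℚᵘ
import Data.Rational.Unnormalised.Properties as ℚᵘₚ
open import Data.List using ([]; _∷_)
open import Data.Product using (_,_)
open import Data.Maybe using (Maybe; just; nothing)
open import Data.Empty using (⊥-elim)
open import Level using (0ℓ)
open import Relation.Nullary using (yes; no)
open import Relation.Binary.PropositionalEquality
open import Tactic.RingSolver using (solve-∀; solve)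
open import Tactic.RingSolver.Core.AlmostCommutativeRing using (AlmostCommutativeRing; fromCommutativeRing)

-- Identities whose atoms are related (say 1/i! = (1 + i)·1/(i+1)!) are stated
-- with the relations as hypotheses  x ≡ …  on implicit variables: matching
-- them with refl substitutes the relation, leaving a polynomial identity.
ℚ-ring : AlmostCommutativeRing 0ℓ 0ℓ
ℚ-ring = fromCommutativeRing +-*-commutativeRing isZero
  where
  isZero : ∀ x → Maybe (0ℚ ≡ x)
  isZero x with 0ℚ ≟ x
  ... | yes 0≡x = just 0≡x
  ... | no  _   = nothing

-- The embedding ℕ → ℚ is additive; passing to unnormalised rationals with
-- denominator 1 reduces this to an identity between integers.
fromℕ-+ : ∀ m n → fromℕ (m ℕ.+ n) ≡ fromℕ m + fromℕ n
fromℕ-+ m n = toℚᵘ-injective (begin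
  toℚᵘ (fromℕ (m ℕ.+ n))           ≈⟨ toℚᵘ-fromℚᵘ (ℚᵘ.mkℚᵘ (+ (m ℕ.+ n)) 0) ⟩
  ℚᵘ.mkℚᵘ (+ (m ℕ.+ n)) 0           ≈⟨ ℚᵘ.*≡* sum≡ ⟩
  ℚᵘ.mkℚᵘ (+ m) 0 ℚᵘ.+ ℚᵘ.mkℚᵘ (+ n) 0
    ≈⟨ ℚᵘₚ.+-cong (ℚᵘₚ.≃-sym (toℚᵘ-fromℚᵘ (ℚᵘ.mkℚᵘ (+ m) 0)))
                (ℚᵘₚ.≃-sym (toℚᵘ-fromℚᵘ (ℚᵘ.mkℚᵘ (+ n) 0))) ⟩
  toℚᵘ (fromℕ m) ℚᵘ.+ toℚᵘ (fromℕ n) ≈⟨ ℚᵘₚ.≃-sym (toℚᵘ-homo-+ (fromℕ m) (fromℕ n)) ⟩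
  toℚᵘ (fromℕ m + fromℕ n)           ∎)
  where
  open ℚᵘₚ.≃-Reasoning
  sum≡ : + (m ℕ.+ n) ℤ.* + 1 ≡ (+ m ℤ.* + 1 ℤ.+ + n ℤ.* + 1) ℤ.* + 1
  sum≡ rewrite ℤₚ.*-identityʳ (+ m) | ℤₚ.*-identityʳ (+ n) = refl

fromℕ-suc : ∀ n → fromℕ (suc n) ≡ 1ℚ + fromℕ n
fromℕ-suc = fromℕ-+ 1

fromℕ-suc-pos : ∀ n → Positive (fromℕ (suc n))
fromℕ-suc-pos n = normalize-pos (suc n) 1

factQ-pos : ∀ n → Positive (factQ n)
factQ-pos zero    = _
factQ-pos (suc n) = pos*pos⇒pos (fromℕ (suc n)) {{fromℕ-suc-pos n}} (factQ n) {{factQ-pos n}}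

poch-pos : ∀ a .{{_ : Positive a}} n → Positive (poch a n)
poch-pos a zero    = _
poch-pos a (suc n) = pos*pos⇒pos (poch a n) {{poch-pos a n}} (a + fromℕ n)
  {{pos+nonNeg⇒pos a (fromℕ n) {{normalize-nonNeg n 1}}}}

inv-inverseˡ : ∀ q .{{_ : Positive q}} → inv q * q ≡ 1ℚ
inv-inverseˡ q with q ≟ 0ℚ
... | yes refl = ⊥-elim (<-irrefl refl (positive⁻¹ 0ℚ))
... | no _     = *-inverseˡ q {{pos⇒nonZero q}}

solve-for : ∀ x y d .{{_ : Positive d}} → x * d ≡ y → x ≡ y * inv d
solve-for x y d xd≡y = begin
  x                  ≡⟨ sym (*-identityʳ x) ⟩
  x * 1ℚ             ≡⟨ cong (x *_) (sym (trans (*-comm d (inv d)) (inv-inverseˡ d))) ⟩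
  x * (d * inv d)    ≡⟨ sym (*-assoc x d (inv d)) ⟩
  x * d * inv d      ≡⟨ cong (_* inv d) xd≡y ⟩
  y * inv d          ∎
  where open ≡-Reasoning

invFact : ℕ → ℚ
invFact n = inv (factQ n)

fact-invFact : ∀ n → factQ n * invFact n ≡ 1ℚ
fact-invFact n = trans (*-comm (factQ n) (invFact n)) (inv-inverseˡ (factQ n) {{factQ-pos n}})

invFact-suc : ∀ n → invFact n ≡ (1ℚ + fromℕ n) * invFact (suc n)
invFact-suc n = begin
  invFact n
    ≡⟨ sym (*-identityˡ (invFact n)) ⟩
  1ℚ * invFact n
    ≡⟨ cong (_* invFact n) (sym (fact-invFact (suc n))) ⟩
  factQ (suc n) * invFact (suc n) * invFact n
    ≡⟨ reorder (fromℕ (suc n)) (factQ n) (invFact (suc n)) (invFact n) ⟩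
  fromℕ (suc n) * invFact (suc n) * (factQ n * invFact n)
    ≡⟨ cong₂ (λ s t → s * invFact (suc n) * t) (fromℕ-suc n) (fact-invFact n) ⟩
  (1ℚ + fromℕ n) * invFact (suc n) * 1ℚ
    ≡⟨ *-identityʳ ((1ℚ + fromℕ n) * invFact (suc n)) ⟩
  (1ℚ + fromℕ n) * invFact (suc n) ∎
  where
  open ≡-Reasoning
  reorder : ∀ s f i j → s * f * i * j ≡ s * i * (f * j)
  reorder = solve-∀ ℚ-ring

factQ-suc : ∀ n → factQ (suc n) ≡ (1ℚ + fromℕ n) * factQ n
factQ-suc n = cong (_* factQ n) (fromℕ-suc n)

^-+ : ∀ q m n → q ^ (m ℕ.+ n) ≡ q ^ m * q ^ n
^-+ q zero    n = sym (*-identityˡ (q ^ n))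
^-+ q (suc m) n = trans (cong (q *_) (^-+ q m n)) (sym (*-assoc q (q ^ m) (q ^ n)))

^-* : ∀ p q n → (p * q) ^ n ≡ p ^ n * q ^ n
^-* p q zero    = refl
^-* p q (suc n) = trans (cong ((p * q) *_) (^-* p q n)) (interchange p q (p ^ n) (q ^ n))
  where
  interchange : ∀ a b c d → (a * b) * (c * d) ≡ (a * c) * (b * d)
  interchange = solve-∀ ℚ-ring

1^ : ∀ n → 1ℚ ^ n ≡ 1ℚ
1^ zero    = refl
1^ (suc n) = trans (*-identityˡ (1ℚ ^ n)) (1^ n)

sumTo-cong≤ : ∀ n {h g : ℕ → ℚ} → (∀ i → i ≤ n → h i ≡ g i) → sumTo n h ≡ sumTo n g
sumTo-cong≤ zero    h≡g = h≡g 0 ℕ.z≤n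
sumTo-cong≤ (suc n) h≡g =
  cong₂ _+_ (sumTo-cong≤ n (λ i i≤n → h≡g i (ℕₚ.m≤n⇒m≤1+n i≤n))) (h≡g (suc n) ℕₚ.≤-refl)

sumTo-cong : ∀ n {h g : ℕ → ℚ} → (∀ i → h i ≡ g i) → sumTo n h ≡ sumTo n g
sumTo-cong n h≡g = sumTo-cong≤ n (λ i _ → h≡g i)

sumTo-zero : ∀ n {h : ℕ → ℚ} → (∀ i → h i ≡ 0ℚ) → sumTo n h ≡ 0ℚ
sumTo-zero zero    h≡0 = h≡0 0
sumTo-zero (suc n) h≡0 = trans (cong₂ _+_ (sumTo-zero n h≡0) (h≡0 (suc n))) (+-identityʳ 0ℚ)

sumTo-+ : ∀ n (h g : ℕ → ℚ) → sumTo n (λ i → h i + g i) ≡ sumTo n h + sumTo n g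
sumTo-+ zero    h g = refl
sumTo-+ (suc n) h g = trans (cong (_+ (h (suc n) + g (suc n))) (sumTo-+ n h g))
  (interchange (sumTo n h) (sumTo n g) (h (suc n)) (g (suc n)))
  where
  interchange : ∀ a b c d → (a + b) + (c + d) ≡ (a + c) + (b + d)
  interchange = solve-∀ ℚ-ring

sumTo-*ˡ : ∀ n c (h : ℕ → ℚ) → sumTo n (λ i → c * h i) ≡ c * sumTo n h
sumTo-*ˡ zero    c h = refl
sumTo-*ˡ (suc n) c h =
  trans (cong (_+ c * h (suc n)) (sumTo-*ˡ n c h)) (sym (*-distribˡ-+ c _ _))

sumTo-*ʳ : ∀ n c (h : ℕ → ℚ) → sumTo n (λ i → h i * c) ≡ sumTo n h * c
sumTo-*ʳ n c h = trans (sumTo-cong n (λ i → *-comm (h i) c)) (trans (sumTo-*ˡ n c h) (*-comm c _))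

sumTo-linear : ∀ n p c (a b : ℕ → ℚ) →
  sumTo n (λ i → p * a i - c * b i) ≡ p * sumTo n a - c * sumTo n b
sumTo-linear zero    p c a b = refl
sumTo-linear (suc n) p c a b =
  trans (cong (_+ (p * a (suc n) - c * b (suc n))) (sumTo-linear n p c a b))
        (regroup p c (sumTo n a) (sumTo n b) (a (suc n)) (b (suc n)))
  where
  regroup : ∀ p c A B x y → (p * A - c * B) + (p * x - c * y) ≡ p * (A + x) - c * (B + y)
  regroup = solve-∀ ℚ-ring

sumTo-swap : ∀ n k (h : ℕ → ℕ → ℚ) →
  sumTo n (λ i → sumTo k (h i)) ≡ sumTo k (λ j → sumTo n (λ i → h i j))
sumTo-swap zero    k h = refl
sumTo-swap (suc n) k h = trans (cong (_+ sumTo k (h (suc n))) (sumTo-swap n k h))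
  (sym (sumTo-+ k (λ j → sumTo n (λ i → h i j)) (h (suc n))))

sumTo-head : ∀ n (h : ℕ → ℚ) → sumTo (suc n) h ≡ h 0 + sumTo n (λ i → h (suc i))
sumTo-head zero    h = refl
sumTo-head (suc n) h = trans (cong (_+ h (suc (suc n))) (sumTo-head n h)) (+-assoc (h 0) _ _)

sumTo-first : ∀ n (h : ℕ → ℚ) → (∀ i → h (suc i) ≡ 0ℚ) → sumTo n h ≡ h 0
sumTo-first zero    h _   = refl
sumTo-first (suc n) h h≡0 =
  trans (sumTo-head n h) (trans (cong (λ s → h 0 + s) (sumTo-zero n h≡0)) (+-identityʳ (h 0)))

sumTo-last : ∀ n (h : ℕ → ℚ) → (∀ i → i ℕ.< n → h i ≡ 0ℚ) → sumTo n h ≡ h n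
sumTo-last zero    h _   = refl
sumTo-last (suc n) h h≡0 = trans (cong (_+ h (suc n)) earlier-vanish) (+-identityˡ (h (suc n)))
  where
  earlier-vanish : sumTo n h ≡ 0ℚ
  earlier-vanish = trans (sumTo-cong≤ n (λ i i≤n → h≡0 i (ℕ.s≤s i≤n))) (sumTo-zero n (λ _ → refl))

telescope : ∀ m (F G : ℕ → ℚ) → (∀ j → j ≤ m → F j ≡ G j - G (suc j)) →
  sumTo m F ≡ G 0 - G (suc m)
telescope zero    F G F≡ΔG = F≡ΔG 0 ℕ.z≤n
telescope (suc m) F G F≡ΔG =
  trans (cong₂ _+_ (telescope m F G (λ j j≤m → F≡ΔG j (ℕₚ.m≤n⇒m≤1+n j≤m)))
                   (F≡ΔG (suc m) ℕₚ.≤-refl))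
        (cancel (G 0) (G (suc m)) (G (suc (suc m))))
  where
  cancel : ∀ a b c → (a - b) + (b - c) ≡ a - c
  cancel = solve-∀ ℚ-ring

antidiagonal : (ℕ → ℕ → ℚ) → ℕ → ℚ
antidiagonal T m = sumTo m (λ j → T j (m ∸ j))

-- Coefficients of x·g(x) in terms of those of g(x).
shift : (ℕ → ℚ) → ℕ → ℚ
shift g zero    = 0ℚ
shift g (suc n) = g n

shift-cong : ∀ (g h : ℕ → ℚ) → (∀ i → g i ≡ h i) → ∀ n → shift g n ≡ shift h n
shift-cong g h g≡h zero    = refl
shift-cong g h g≡h (suc n) = g≡h n

shift-* : ∀ α (g : ℕ → ℚ) n → shift (λ i → α * g i) n ≡ α * shift g n
shift-* α g zero    = sym (*-zeroʳ α)
shift-* α g (suc n) = refl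

antidiagonal-deg≤1 : ∀ (T : ℕ → ℕ → ℚ) m → (∀ j k → T (suc (suc j)) k ≡ 0ℚ) →
  antidiagonal T m ≡ T 0 m + shift (T 1) m
antidiagonal-deg≤1 T zero    _   = sym (+-identityʳ (T 0 0))
antidiagonal-deg≤1 T (suc m) T≡0 = trans (sumTo-head m (λ j → T j (suc m ∸ j)))
  (cong (λ s → T 0 (suc m) + s) (sumTo-first m (λ j → T (suc j) (m ∸ j)) (λ j → T≡0 j (m ∸ suc j))))

creative-telescoping : ∀ (T U : ℕ → ℕ → ℚ) (p c : ℚ) m →
  (∀ j k → j ℕ.+ k ≡ m → p * T j (suc k) - c * T j k ≡ U j (suc k) - U (suc j) k) →
  U 0 (suc m) ≡ 0ℚ → p * T (suc m) 0 ≡ U (suc m) 0 →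
  p * antidiagonal T (suc m) ≡ c * antidiagonal T m
creative-telescoping T U p c m certificate start end = begin
  p * (S + T (suc m) (m ∸ m))
    ≡⟨ cong (λ k → p * (S + T (suc m) k)) (ℕₚ.n∸n≡0 m) ⟩
  p * (S + T (suc m) 0)
    ≡⟨ expand p c S A (T (suc m) 0) ⟩
  (p * S - c * A) + c * A + p * T (suc m) 0
    ≡⟨ cong₂ (λ d e → d + c * A + e) telescoped end ⟩
  (U 0 (suc m) - U (suc m) 0) + c * A + U (suc m) 0
    ≡⟨ cong (λ u → (u - U (suc m) 0) + c * A + U (suc m) 0) start ⟩
  (0ℚ - U (suc m) 0) + c * A + U (suc m) 0
    ≡⟨ collapse (c * A) (U (suc m) 0) ⟩
  c * A ∎
  where
  open ≡-Reasoning
  S = sumTo m (λ j → T j (suc m ∸ j))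
  A = antidiagonal T m
  expand : ∀ p c S A t → p * (S + t) ≡ (p * S - c * A) + c * A + p * t
  expand = solve-∀ ℚ-ring
  collapse : ∀ a u → (0ℚ - u) + a + u ≡ a
  collapse = solve-∀ ℚ-ring
  step : ∀ j → j ≤ m →
    p * T j (suc m ∸ j) - c * T j (m ∸ j) ≡ U j (suc m ∸ j) - U (suc j) (m ∸ j)
  step j j≤m rewrite ℕₚ.+-∸-assoc 1 j≤m = certificate j (m ∸ j) (ℕₚ.m+[n∸m]≡n j≤m)
  telescoped : p * S - c * A ≡ U 0 (suc m) - U (suc m) 0
  telescoped = begin
    p * S - c * A
      ≡⟨ sym (sumTo-linear m p c (λ j → T j (suc m ∸ j)) (λ j → T j (m ∸ j))) ⟩
    sumTo m (λ j → p * T j (suc m ∸ j) - c * T j (m ∸ j))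
      ≡⟨ telescope m _ (λ j → U j (suc m ∸ j)) step ⟩
    U 0 (suc m) - U (suc m) (m ∸ m)
      ≡⟨ cong (λ k → U 0 (suc m) - U (suc m) k) (ℕₚ.n∸n≡0 m) ⟩
    U 0 (suc m) - U (suc m) 0 ∎

recurrence-solution : ∀ (S w T p c : ℕ → ℚ) →
  (∀ m → p m * S (suc m) ≡ c m * S m) →
  (∀ m → w (suc m) ≡ p m * w m) → (∀ m → T (suc m) ≡ T m * c m) →
  S 0 * w 0 ≡ T 0 → ∀ m → S m * w m ≡ T m
recurrence-solution S w T p c rec w-rec T-rec initial zero    = initial
recurrence-solution S w T p c rec w-rec T-rec initial (suc m) = begin
  S (suc m) * w (suc m)     ≡⟨ cong (S (suc m) *_) (w-rec m) ⟩
  S (suc m) * (p m * w m)   ≡⟨ rearrange (S (suc m)) (p m) (w m) ⟩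
  p m * S (suc m) * w m     ≡⟨ cong (_* w m) (rec m) ⟩
  c m * S m * w m           ≡⟨ rearrange′ (c m) (S m) (w m) ⟩
  S m * w m * c m           ≡⟨ cong (_* c m) (recurrence-solution S w T p c rec w-rec T-rec initial m) ⟩
  T m * c m                 ≡⟨ sym (T-rec m) ⟩
  T (suc m)                 ∎
  where
  open ≡-Reasoning
  rearrange : ∀ s p w → s * (p * w) ≡ p * s * w
  rearrange = solve-∀ ℚ-ring
  rearrange′ : ∀ c s w → c * s * w ≡ s * w * c
  rearrange′ = solve-∀ ℚ-ring

poch-+ : ∀ c j i → poch c (j ℕ.+ i) ≡ poch c j * poch (c + fromℕ j) i
poch-+ c j zero = trans (cong (poch c) (ℕₚ.+-identityʳ j)) (sym (*-identityʳ (poch c j)))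
poch-+ c j (suc i) = begin
  poch c (j ℕ.+ suc i)
    ≡⟨ cong (poch c) (ℕₚ.+-suc j i) ⟩
  poch c (j ℕ.+ i) * (c + fromℕ (j ℕ.+ i))
    ≡⟨ cong₂ (λ P s → P * (c + s)) (poch-+ c j i) (fromℕ-+ j i) ⟩
  poch c j * poch (c + fromℕ j) i * (c + (fromℕ j + fromℕ i))
    ≡⟨ regroup (poch c j) (poch (c + fromℕ j) i) c (fromℕ j) (fromℕ i) ⟩
  poch c j * poch (c + fromℕ j) (suc i) ∎
  where
  open ≡-Reasoning
  regroup : ∀ P Q c a b → P * Q * (c + (a + b)) ≡ P * (Q * (c + a + b))
  regroup = solve-∀ ℚ-ring

poch-one : ∀ n → poch 1ℚ n ≡ factQ n
poch-one zero    = refl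
poch-one (suc n) = trans (cong₂ _*_ (poch-one n) (sym (fromℕ-suc n))) (*-comm (factQ n) _)

fact-+ : ∀ n k → factQ (n ℕ.+ k) ≡ factQ n * poch (1ℚ + fromℕ n) k
fact-+ n k = begin
  factQ (n ℕ.+ k)                         ≡⟨ sym (poch-one (n ℕ.+ k)) ⟩
  poch 1ℚ (n ℕ.+ k)                       ≡⟨ poch-+ 1ℚ n k ⟩
  poch 1ℚ n * poch (1ℚ + fromℕ n) k       ≡⟨ cong (_* poch (1ℚ + fromℕ n) k) (poch-one n) ⟩
  factQ n * poch (1ℚ + fromℕ n) k         ∎
  where open ≡-Reasoning

falling-sign : ∀ α n → fallingQ α n * (- 1ℚ) ^ n ≡ poch (- α) n
falling-sign α zero    = refl
falling-sign α (suc n) = trans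
  (regroup (fallingQ α n) α (fromℕ n) ((- 1ℚ) ^ n))
  (cong (_* (- α + fromℕ n)) (falling-sign α n))
  where
  regroup : ∀ F a k s → F * (a - k) * (- 1ℚ * s) ≡ F * s * (- a + k)
  regroup = solve-∀ ℚ-ring

poch-triplication : ∀ x n → poch (fromℕ 3 * x) (n ℕ.+ n ℕ.+ n)
  ≡ poch x n * poch (x + (+ 1) / 3) n * poch (x + (+ 2) / 3) n * fromℕ 27 ^ n
poch-triplication x zero    = refl
poch-triplication x (suc n) = begin
  poch y (suc n ℕ.+ suc n ℕ.+ suc n)
    ≡⟨ cong (poch y) (three-more n) ⟩
  poch y N * (y + fromℕ N) * (y + fromℕ (suc N)) * (y + fromℕ (suc (suc N)))
    ≡⟨ cong (λ P → P * (y + fromℕ N) * (y + fromℕ (suc N)) * (y + fromℕ (suc (suc N))))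
            (poch-triplication x n) ⟩
  poch x n * poch (x + (+ 1) / 3) n * poch (x + (+ 2) / 3) n * fromℕ 27 ^ n
    * (y + fromℕ N) * (y + fromℕ (suc N)) * (y + fromℕ (suc (suc N)))
    ≡⟨ identity x (fromℕ n) (poch x n) (poch (x + (+ 1) / 3) n) (poch (x + (+ 2) / 3) n) (fromℕ 27 ^ n)
                fromℕ-N fromℕ-N+1 (trans (fromℕ-suc (suc N)) (cong (λ ν → 1ℚ + ν) fromℕ-N+1)) ⟩
  poch x (suc n) * poch (x + (+ 1) / 3) (suc n) * poch (x + (+ 2) / 3) (suc n) * fromℕ 27 ^ suc n ∎
  where
  open ≡-Reasoning
  y = fromℕ 3 * x
  N = n ℕ.+ n ℕ.+ n
  three-more : ∀ n → suc n ℕ.+ suc n ℕ.+ suc n ≡ suc (suc (suc (n ℕ.+ n ℕ.+ n)))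
  three-more = ℕ-Solver.solve-∀
  fromℕ-N : fromℕ N ≡ fromℕ n + fromℕ n + fromℕ n
  fromℕ-N = trans (fromℕ-+ (n ℕ.+ n) n) (cong (_+ fromℕ n) (fromℕ-+ n n))
  fromℕ-N+1 : fromℕ (suc N) ≡ 1ℚ + (fromℕ n + fromℕ n + fromℕ n)
  fromℕ-N+1 = trans (fromℕ-suc N) (cong (λ ν → 1ℚ + ν) fromℕ-N)
  -- (3x + 3k)(3x + 3k + 1)(3x + 3k + 2) = 27 (x + k)(x + 1/3 + k)(x + 2/3 + k)
  identity : ∀ x k P₁ P₂ P₃ W {ν₀ ν₁ ν₂} →
    ν₀ ≡ k + k + k → ν₁ ≡ 1ℚ + (k + k + k) → ν₂ ≡ 1ℚ + (1ℚ + (k + k + k)) →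
    P₁ * P₂ * P₃ * W * (fromℕ 3 * x + ν₀) * (fromℕ 3 * x + ν₁) * (fromℕ 3 * x + ν₂)
    ≡ P₁ * (x + k) * (P₂ * (x + (+ 1) / 3 + k)) * (P₃ * (x + (+ 2) / 3 + k)) * (fromℕ 27 * W)
  identity x k P₁ P₂ P₃ W refl refl refl = solve (x ∷ k ∷ P₁ ∷ P₂ ∷ P₃ ∷ W ∷ []) ℚ-ring

vandermonde-term : ℚ → ℚ → ℕ → ℕ → ℚ
vandermonde-term A B i k = poch A i * poch B k * invFact i * invFact k

-- The WZ certificate of Chu–Vandermonde is U i k = i · term i k.  After
-- expressing 1/i!, 1/k!, i+1 and m+1 through the atoms of the next index
-- the certificate identity is polynomial.
vandermonde-certificate : ∀ A B m i k → i ℕ.+ k ≡ m →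
  fromℕ (suc m) * vandermonde-term A B i (suc k) - (A + B + fromℕ m) * vandermonde-term A B i k
  ≡ fromℕ i * vandermonde-term A B i (suc k) - fromℕ (suc i) * vandermonde-term A B (suc i) k
vandermonde-certificate A B .(i ℕ.+ k) i k refl =
  identity A B (fromℕ i) (fromℕ k) (poch A i) (poch B k) (invFact (suc i)) (invFact (suc k))
           (invFact-suc i) (invFact-suc k) (fromℕ-suc i)
           (trans (fromℕ-suc (i ℕ.+ k)) (cong (λ x → 1ℚ + x) (fromℕ-+ i k))) (fromℕ-+ i k)
  where
  -- a = i, b = k, P = (A)_i, Q = (B)_k, I = 1/i!, I₁ = 1/(i+1)!, K = 1/k!, K₁ = 1/(k+1)!
  identity : ∀ A B a b P Q I₁ K₁ {I K s₁ s c} →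
    I ≡ (1ℚ + a) * I₁ → K ≡ (1ℚ + b) * K₁ → s₁ ≡ 1ℚ + a → s ≡ 1ℚ + (a + b) → c ≡ a + b →
    s * (P * (Q * (B + b)) * I * K₁) - (A + B + c) * (P * Q * I * K)
    ≡ a * (P * (Q * (B + b)) * I * K₁) - s₁ * (P * (A + a) * Q * I₁ * K)
  identity A B a b P Q I₁ K₁ refl refl refl refl refl =
    solve (A ∷ B ∷ a ∷ b ∷ P ∷ Q ∷ I₁ ∷ K₁ ∷ []) ℚ-ring

vandermonde : ∀ A B m → antidiagonal (vandermonde-term A B) m ≡ poch (A + B) m * invFact m
vandermonde A B m = solve-for (antidiagonal (vandermonde-term A B) m) (poch (A + B) m) (factQ m) {{factQ-pos m}}
  (recurrence-solution (antidiagonal (vandermonde-term A B)) factQ (poch (A + B))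
    (λ n → fromℕ (suc n)) (λ n → A + B + fromℕ n) recurrence (λ _ → refl) (λ _ → refl) initial m)
  where
  -- (m+1) S_{m+1} = (A + B + m) S_m, while (m+1)! and (A+B)_{m+1} obey the same recursion
  recurrence : ∀ m → fromℕ (suc m) * antidiagonal (vandermonde-term A B) (suc m)
                     ≡ (A + B + fromℕ m) * antidiagonal (vandermonde-term A B) m
  recurrence m = creative-telescoping (vandermonde-term A B) (λ i k → fromℕ i * vandermonde-term A B i k)
    (fromℕ (suc m)) (A + B + fromℕ m) m (vandermonde-certificate A B m)
    (*-zeroˡ (vandermonde-term A B 0 (suc m))) refl
  initial : vandermonde-term A B 0 0 * 1ℚ ≡ 1ℚ
  initial = refl

⅓ ⅔ : ℚ
⅓ = (+ 1) / 3
⅔ = (+ 2) / 3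

-- Summand of the sum over j that remains of the diagonal coefficient, in the
-- antidiagonal variables (j, k = m − j):  (−2/3)_j 2^j (2m − j)! / (j! (m − j)!).
outer-term : ℕ → ℕ → ℚ
outer-term j k = poch (- ⅔) j * fromℕ 2 ^ j * invFact j * invFact k * factQ (j ℕ.+ k ℕ.+ k)

outer-certificate-term : ℕ → ℕ → ℕ → ℚ
outer-certificate-term m j l =
  fromℕ j * ((⅔ + fromℕ m) * poch (- ⅔) j * fromℕ 2 ^ j * invFact j * invFact l * factQ (m ℕ.+ l))

outer-certificate : ∀ m j k → j ℕ.+ k ≡ m →
  (⅔ + fromℕ m) * outer-term j (suc k)
    - (⅓ + fromℕ (m ℕ.+ m)) * (⅓ + fromℕ (suc (m ℕ.+ m))) * outer-term j k
  ≡ outer-certificate-term m j (suc k) - outer-certificate-term m (suc j) k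
outer-certificate .(j ℕ.+ k) j k refl =
  identity (fromℕ j) (fromℕ k) (poch (- ⅔) j) (fromℕ 2 ^ j) (invFact (suc j)) (invFact (suc k)) (factQ N)
    (invFact-suc j) (invFact-suc k) (fromℕ-suc j) (fromℕ-+ j k) fromℕ-2m fromℕ-2m+1
    (trans (cong factQ (N+2 j k)) fact-N+2) (trans (cong factQ (N+1 j k)) fact-N+1)
  where
  N = j ℕ.+ k ℕ.+ k
  fromℕ-N : fromℕ N ≡ fromℕ j + fromℕ k + fromℕ k
  fromℕ-N = trans (fromℕ-+ (j ℕ.+ k) k) (cong (_+ fromℕ k) (fromℕ-+ j k))
  fromℕ-N+1 : fromℕ (suc N) ≡ 1ℚ + (fromℕ j + fromℕ k + fromℕ k)
  fromℕ-N+1 = trans (fromℕ-suc N) (cong (λ x → 1ℚ + x) fromℕ-N)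
  fromℕ-2m : fromℕ (j ℕ.+ k ℕ.+ (j ℕ.+ k)) ≡ (fromℕ j + fromℕ k) + (fromℕ j + fromℕ k)
  fromℕ-2m = trans (fromℕ-+ (j ℕ.+ k) (j ℕ.+ k)) (cong₂ _+_ (fromℕ-+ j k) (fromℕ-+ j k))
  fromℕ-2m+1 : fromℕ (suc (j ℕ.+ k ℕ.+ (j ℕ.+ k))) ≡ 1ℚ + ((fromℕ j + fromℕ k) + (fromℕ j + fromℕ k))
  fromℕ-2m+1 = trans (fromℕ-suc (j ℕ.+ k ℕ.+ (j ℕ.+ k))) (cong (λ x → 1ℚ + x) fromℕ-2m)
  fact-N+1 : factQ (suc N) ≡ (1ℚ + (fromℕ j + fromℕ k + fromℕ k)) * factQ N
  fact-N+1 = trans (factQ-suc N) (cong (λ x → (1ℚ + x) * factQ N) fromℕ-N)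
  fact-N+2 : factQ (suc (suc N))
             ≡ (1ℚ + (1ℚ + (fromℕ j + fromℕ k + fromℕ k))) * ((1ℚ + (fromℕ j + fromℕ k + fromℕ k)) * factQ N)
  fact-N+2 = trans (factQ-suc (suc N)) (cong₂ (λ x F → (1ℚ + x) * F) fromℕ-N+1 fact-N+1)
  N+1 : ∀ j k → j ℕ.+ k ℕ.+ suc k ≡ suc (j ℕ.+ k ℕ.+ k)
  N+1 = ℕ-Solver.solve-∀
  N+2 : ∀ j k → j ℕ.+ suc k ℕ.+ suc k ≡ suc (suc (j ℕ.+ k ℕ.+ k))
  N+2 = ℕ-Solver.solve-∀
  -- a = j, b = k, P = (−2/3)_j, W = 2^j, I₁ = 1/(j+1)!, K₁ = 1/(k+1)!, F = (j+2k)!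
  identity : ∀ a b P W I₁ K₁ F {I K s₁ μ ν ν₁ G₂ G₁} →
    I ≡ (1ℚ + a) * I₁ → K ≡ (1ℚ + b) * K₁ → s₁ ≡ 1ℚ + a → μ ≡ a + b →
    ν ≡ (a + b) + (a + b) → ν₁ ≡ 1ℚ + ((a + b) + (a + b)) →
    G₂ ≡ (1ℚ + (1ℚ + (a + b + b))) * ((1ℚ + (a + b + b)) * F) → G₁ ≡ (1ℚ + (a + b + b)) * F →
    (⅔ + μ) * (P * W * I * K₁ * G₂) - (⅓ + ν) * (⅓ + ν₁) * (P * W * I * K * F)
    ≡ a * ((⅔ + μ) * P * W * I * K₁ * G₁)
      - s₁ * ((⅔ + μ) * (P * (- ⅔ + a)) * (fromℕ 2 * W) * I₁ * K * F)
  identity a b P W I₁ K₁ F refl refl refl refl refl refl refl refl =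
    solve (a ∷ b ∷ P ∷ W ∷ I₁ ∷ K₁ ∷ F ∷ []) ℚ-ring

outer-sum : ∀ m → antidiagonal outer-term m * poch ⅔ m ≡ poch ⅓ (m ℕ.+ m)
outer-sum = recurrence-solution (antidiagonal outer-term) (poch ⅔) (λ m → poch ⅓ (m ℕ.+ m))
  (λ m → ⅔ + fromℕ m) (λ m → (⅓ + fromℕ (m ℕ.+ m)) * (⅓ + fromℕ (suc (m ℕ.+ m))))
  recurrence (λ m → *-comm (poch ⅔ m) (⅔ + fromℕ m)) double-step initial
  where
  recurrence : ∀ m → (⅔ + fromℕ m) * antidiagonal outer-term (suc m)
    ≡ (⅓ + fromℕ (m ℕ.+ m)) * (⅓ + fromℕ (suc (m ℕ.+ m))) * antidiagonal outer-term m
  recurrence m = creative-telescoping outer-term (outer-certificate-term m)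
    (⅔ + fromℕ m) ((⅓ + fromℕ (m ℕ.+ m)) * (⅓ + fromℕ (suc (m ℕ.+ m)))) m
    (outer-certificate m) start end
    where
    start : outer-certificate-term m 0 (suc m) ≡ 0ℚ
    start = *-zeroˡ ((⅔ + fromℕ m) * 1ℚ * 1ℚ * invFact 0 * invFact (suc m) * factQ (m ℕ.+ suc m))
    -- the new last term matches the certificate because (m+1)! = (m+1)·m!
    end : (⅔ + fromℕ m) * outer-term (suc m) 0 ≡ outer-certificate-term m (suc m) 0
    end = shuffle (⅔ + fromℕ m) (poch (- ⅔) (suc m)) (fromℕ 2 ^ suc m) (invFact (suc m)) (invFact 0)
      (cong (λ n → fromℕ (suc n)) (trans (ℕₚ.+-identityʳ (m ℕ.+ 0)) (ℕₚ.+-identityʳ m)))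
      (cong factQ (ℕₚ.+-identityʳ (m ℕ.+ 0)))
      where
      shuffle : ∀ c P W I J {s s′ F F′} → s ≡ s′ → F ≡ F′ →
        c * (P * W * I * J * (s * F)) ≡ s′ * (c * P * W * I * J * F′)
      shuffle c P W I J {s} {F = F} refl refl = solve (c ∷ P ∷ W ∷ I ∷ J ∷ s ∷ F ∷ []) ℚ-ring
  double-step : ∀ m → poch ⅓ (suc m ℕ.+ suc m)
    ≡ poch ⅓ (m ℕ.+ m) * ((⅓ + fromℕ (m ℕ.+ m)) * (⅓ + fromℕ (suc (m ℕ.+ m))))
  double-step m = trans (cong (λ n → poch ⅓ (suc n)) (ℕₚ.+-suc m m))
    (*-assoc (poch ⅓ (m ℕ.+ m)) (⅓ + fromℕ (m ℕ.+ m)) (⅓ + fromℕ (suc (m ℕ.+ m))))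
  initial : outer-term 0 0 * 1ℚ ≡ 1ℚ
  initial = refl

linear-⊛ : ∀ α β γ (P : PS3) a b c →
  (linPS α β γ ⊛ P) a b c
    ≡ α * shift (λ a′ → P a′ b c) a + β * shift (λ b′ → P a b′ c) b + γ * shift (λ c′ → P a b c′) c
linear-⊛ α β γ P a b c = begin
  antidiagonal Tx a
    ≡⟨ antidiagonal-deg≤1 Tx a (λ i a′ → vanish₂ (L (suc (suc i))) a′ (λ _ _ → refl)) ⟩
  antidiagonal Ty b + shift (Tx 1) a
    ≡⟨ cong₂ _+_ (antidiagonal-deg≤1 Ty b (λ j b′ → vanish₁ (L 0 (suc (suc j))) a b′ (λ _ → refl)))
                 (shift-cong (Tx 1) (λ a′ → α * P a′ b c) x-part a) ⟩
  (antidiagonal Tz c + shift (Ty 1) b) + shift (λ a′ → α * P a′ b c) a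
    ≡⟨ cong₂ (λ u v → (u + v) + shift (λ a′ → α * P a′ b c) a)
             (antidiagonal-deg≤1 Tz c (λ _ c′ → *-zeroˡ (P a b c′)))
             (shift-cong (Ty 1) (λ b′ → β * P a b′ c) y-part b) ⟩
  ((0ℚ * P a b c + shift (λ c′ → γ * P a b c′) c) + shift (λ b′ → β * P a b′ c) b)
    + shift (λ a′ → α * P a′ b c) a
    ≡⟨ cong₂ (λ u v → ((0ℚ * P a b c + u) + v) + shift (λ a′ → α * P a′ b c) a)
             (shift-* γ (λ c′ → P a b c′) c) (shift-* β (λ b′ → P a b′ c) b) ⟩
  ((0ℚ * P a b c + γ * sz) + β * sy) + shift (λ a′ → α * P a′ b c) a
    ≡⟨ cong (λ u → ((0ℚ * P a b c + γ * sz) + β * sy) + u) (shift-* α (λ a′ → P a′ b c) a) ⟩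
  ((0ℚ * P a b c + γ * sz) + β * sy) + α * sx
    ≡⟨ reorder (P a b c) (α * sx) (β * sy) (γ * sz) ⟩
  α * sx + β * sy + γ * sz ∎
  where
  open ≡-Reasoning
  L = linPS α β γ
  sx = shift (λ a′ → P a′ b c) a
  sy = shift (λ b′ → P a b′ c) b
  sz = shift (λ c′ → P a b c′) c
  Tz : ℕ → ℕ → ℚ
  Tz k c′ = L 0 0 k * P a b c′
  Ty : ℕ → ℕ → ℚ
  Ty j b′ = sumTo c (λ k → L 0 j k * P a b′ (c ∸ k))
  Tx : ℕ → ℕ → ℚ
  Tx i a′ = sumTo b (λ j → sumTo c (λ k → L i j k * P a′ (b ∸ j) (c ∸ k)))
  vanish₁ : ∀ (ℓ : ℕ → ℚ) a′ b′ → (∀ k → ℓ k ≡ 0ℚ) → sumTo c (λ k → ℓ k * P a′ b′ (c ∸ k)) ≡ 0ℚ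
  vanish₁ ℓ a′ b′ ℓ≡0 =
    sumTo-zero c (λ k → trans (cong (_* P a′ b′ (c ∸ k)) (ℓ≡0 k)) (*-zeroˡ (P a′ b′ (c ∸ k))))
  vanish₂ : ∀ (ℓ : ℕ → ℕ → ℚ) a′ → (∀ j k → ℓ j k ≡ 0ℚ) →
    sumTo b (λ j → sumTo c (λ k → ℓ j k * P a′ (b ∸ j) (c ∸ k))) ≡ 0ℚ
  vanish₂ ℓ a′ ℓ≡0 = sumTo-zero b (λ j → vanish₁ (ℓ j) a′ (b ∸ j) (ℓ≡0 j))
  x-part : ∀ a′ → Tx 1 a′ ≡ α * P a′ b c
  x-part a′ = trans (sumTo-first b _ (λ j → vanish₁ (L 1 (suc j)) a′ (b ∸ suc j) (λ _ → refl)))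
                    (sumTo-first c _ (λ k → *-zeroˡ (P a′ (b ∸ 0) (c ∸ suc k))))
  y-part : ∀ b′ → Ty 1 b′ ≡ β * P a b′ c
  y-part b′ = sumTo-first c _ (λ k → *-zeroˡ (P a b′ (c ∸ suc k)))
  reorder : ∀ p x y z → ((0ℚ * p + z) + y) + x ≡ x + y + z
  reorder = solve-∀ ℚ-ring

multinomial : ℚ → ℚ → ℚ → ℕ → ℕ → ℕ → ℕ → ℚ
multinomial α β γ t a b c = factQ t * invFact a * invFact b * invFact c * (α ^ a * β ^ b * γ ^ c)

power-linear-off-degree : ∀ α β γ t a b c → a ℕ.+ b ℕ.+ c ≢ t → powPS (linPS α β γ) t a b c ≡ 0ℚ
power-linear-off-degree α β γ zero zero    zero    zero    a+b+c≢0 = ⊥-elim (a+b+c≢0 refl)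
power-linear-off-degree α β γ zero zero    zero    (suc c) _       = refl
power-linear-off-degree α β γ zero zero    (suc b) c       _       = refl
power-linear-off-degree α β γ zero (suc a) b       c       _       = refl
power-linear-off-degree α β γ (suc t) a b c a+b+c≢t+1 = begin
  powPS (linPS α β γ) (suc t) a b c
    ≡⟨ linear-⊛ α β γ (powPS (linPS α β γ) t) a b c ⟩
  α * shift (λ a′ → powPS (linPS α β γ) t a′ b c) a + β * shift (λ b′ → powPS (linPS α β γ) t a b′ c) b
    + γ * shift (λ c′ → powPS (linPS α β γ) t a b c′) c
    ≡⟨ cong₂ _+_ (cong₂ _+_ (cong (α *_) (along-a a a+b+c≢t+1)) (cong (β *_) (along-b b a+b+c≢t+1)))
                 (cong (γ *_) (along-c c a+b+c≢t+1)) ⟩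
  α * 0ℚ + β * 0ℚ + γ * 0ℚ
    ≡⟨ annihilate α β γ ⟩
  0ℚ ∎
  where
  open ≡-Reasoning
  annihilate : ∀ α β γ → α * 0ℚ + β * 0ℚ + γ * 0ℚ ≡ 0ℚ
  annihilate = solve-∀ ℚ-ring
  along-a : ∀ a → a ℕ.+ b ℕ.+ c ≢ suc t → shift (λ a′ → powPS (linPS α β γ) t a′ b c) a ≡ 0ℚ
  along-a zero    _  = refl
  along-a (suc a) ≢t = power-linear-off-degree α β γ t a b c (λ e → ≢t (cong suc e))
  along-b : ∀ b → a ℕ.+ b ℕ.+ c ≢ suc t → shift (λ b′ → powPS (linPS α β γ) t a b′ c) b ≡ 0ℚ
  along-b zero    _  = refl
  along-b (suc b) ≢t = power-linear-off-degree α β γ t a b c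
    (λ e → ≢t (trans (cong (ℕ._+ c) (ℕₚ.+-suc a b)) (cong suc e)))
  along-c : ∀ c → a ℕ.+ b ℕ.+ c ≢ suc t → shift (λ c′ → powPS (linPS α β γ) t a b c′) c ≡ 0ℚ
  along-c zero    _  = refl
  along-c (suc c) ≢t = power-linear-off-degree α β γ t a b c
    (λ e → ≢t (trans (ℕₚ.+-suc (a ℕ.+ b) c) (cong suc e)))

multinomial-raise-x : ∀ α β γ t a b c →
  α * shift (λ a′ → multinomial α β γ t a′ b c) a ≡ fromℕ a * multinomial α β γ t a b c
multinomial-raise-x α β γ t zero    b c = trans (*-zeroʳ α) (sym (*-zeroˡ (multinomial α β γ t 0 b c)))
multinomial-raise-x α β γ t (suc a) b c =
  identity α (factQ t) (fromℕ a) (invFact (suc a)) (invFact b) (invFact c)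
           (α ^ a) (β ^ b) (γ ^ c) (invFact-suc a) (fromℕ-suc a)
  where
  identity : ∀ α F x I₁ J K A B C {I s} → I ≡ (1ℚ + x) * I₁ → s ≡ 1ℚ + x →
    α * (F * I * J * K * (A * B * C)) ≡ s * (F * I₁ * J * K * (α * A * B * C))
  identity α F x I₁ J K A B C refl refl = solve (α ∷ F ∷ x ∷ I₁ ∷ J ∷ K ∷ A ∷ B ∷ C ∷ []) ℚ-ring

multinomial-raise-y : ∀ α β γ t a b c →
  β * shift (λ b′ → multinomial α β γ t a b′ c) b ≡ fromℕ b * multinomial α β γ t a b c
multinomial-raise-y α β γ t a zero    c = trans (*-zeroʳ β) (sym (*-zeroˡ (multinomial α β γ t a 0 c)))
multinomial-raise-y α β γ t a (suc b) c =
  identity β (factQ t) (fromℕ b) (invFact a) (invFact (suc b)) (invFact c)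
           (α ^ a) (β ^ b) (γ ^ c) (invFact-suc b) (fromℕ-suc b)
  where
  identity : ∀ β F x I J₁ K A B C {J s} → J ≡ (1ℚ + x) * J₁ → s ≡ 1ℚ + x →
    β * (F * I * J * K * (A * B * C)) ≡ s * (F * I * J₁ * K * (A * (β * B) * C))
  identity β F x I J₁ K A B C refl refl = solve (β ∷ F ∷ x ∷ I ∷ J₁ ∷ K ∷ A ∷ B ∷ C ∷ []) ℚ-ring

multinomial-raise-z : ∀ α β γ t a b c →
  γ * shift (λ c′ → multinomial α β γ t a b c′) c ≡ fromℕ c * multinomial α β γ t a b c
multinomial-raise-z α β γ t a b zero    = trans (*-zeroʳ γ) (sym (*-zeroˡ (multinomial α β γ t a b 0)))
multinomial-raise-z α β γ t a b (suc c) =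
  identity γ (factQ t) (fromℕ c) (invFact a) (invFact b) (invFact (suc c))
           (α ^ a) (β ^ b) (γ ^ c) (invFact-suc c) (fromℕ-suc c)
  where
  identity : ∀ γ F x I J K₁ A B C {K s} → K ≡ (1ℚ + x) * K₁ → s ≡ 1ℚ + x →
    γ * (F * I * J * K * (A * B * C)) ≡ s * (F * I * J * K₁ * (A * B * (γ * C)))
  identity γ F x I J K₁ A B C refl refl = solve (γ ∷ F ∷ x ∷ I ∷ J ∷ K₁ ∷ A ∷ B ∷ C ∷ []) ℚ-ring

multinomial-pascal : ∀ α β γ t a b c → a ℕ.+ b ℕ.+ c ≡ suc t →
  α * shift (λ a′ → multinomial α β γ t a′ b c) a + β * shift (λ b′ → multinomial α β γ t a b′ c) b
    + γ * shift (λ c′ → multinomial α β γ t a b c′) c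
  ≡ multinomial α β γ (suc t) a b c
multinomial-pascal α β γ t a b c a+b+c≡t+1 = begin
  α * shift (λ a′ → multinomial α β γ t a′ b c) a + β * shift (λ b′ → multinomial α β γ t a b′ c) b
    + γ * shift (λ c′ → multinomial α β γ t a b c′) c
    ≡⟨ cong₂ _+_ (cong₂ _+_ (multinomial-raise-x α β γ t a b c) (multinomial-raise-y α β γ t a b c))
                 (multinomial-raise-z α β γ t a b c) ⟩
  fromℕ a * M + fromℕ b * M + fromℕ c * M
    ≡⟨ factor (fromℕ a) (fromℕ b) (fromℕ c) M ⟩
  (fromℕ a + fromℕ b + fromℕ c) * M
    ≡⟨ cong (_* M) degree ⟩
  fromℕ (suc t) * M
    ≡⟨ absorb (fromℕ (suc t)) (factQ t) (invFact a) (invFact b) (invFact c) (α ^ a * β ^ b * γ ^ c) ⟩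
  multinomial α β γ (suc t) a b c ∎
  where
  open ≡-Reasoning
  M = multinomial α β γ t a b c
  factor : ∀ x y z M → x * M + y * M + z * M ≡ (x + y + z) * M
  factor = solve-∀ ℚ-ring
  absorb : ∀ s F I J K W → s * (F * I * J * K * W) ≡ s * F * I * J * K * W
  absorb = solve-∀ ℚ-ring
  degree : fromℕ a + fromℕ b + fromℕ c ≡ fromℕ (suc t)
  degree = trans (cong (_+ fromℕ c) (sym (fromℕ-+ a b)))
                 (trans (sym (fromℕ-+ (a ℕ.+ b) c)) (cong fromℕ a+b+c≡t+1))

power-linear : ∀ α β γ t a b c → a ℕ.+ b ℕ.+ c ≡ t →
  powPS (linPS α β γ) t a b c ≡ multinomial α β γ t a b c
power-linear α β γ zero    zero zero zero refl = refl
power-linear α β γ (suc t) a b c a+b+c≡t+1 = begin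
  powPS (linPS α β γ) (suc t) a b c
    ≡⟨ linear-⊛ α β γ (powPS (linPS α β γ) t) a b c ⟩
  α * shift (λ a′ → powPS (linPS α β γ) t a′ b c) a + β * shift (λ b′ → powPS (linPS α β γ) t a b′ c) b
    + γ * shift (λ c′ → powPS (linPS α β γ) t a b c′) c
    ≡⟨ cong₂ _+_ (cong₂ _+_ (cong (α *_) (along-a a a+b+c≡t+1)) (cong (β *_) (along-b b a+b+c≡t+1)))
                 (cong (γ *_) (along-c c a+b+c≡t+1)) ⟩
  α * shift (λ a′ → multinomial α β γ t a′ b c) a + β * shift (λ b′ → multinomial α β γ t a b′ c) b
    + γ * shift (λ c′ → multinomial α β γ t a b c′) c
    ≡⟨ multinomial-pascal α β γ t a b c a+b+c≡t+1 ⟩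
  multinomial α β γ (suc t) a b c ∎
  where
  open ≡-Reasoning
  along-a : ∀ a → a ℕ.+ b ℕ.+ c ≡ suc t →
    shift (λ a′ → powPS (linPS α β γ) t a′ b c) a ≡ shift (λ a′ → multinomial α β γ t a′ b c) a
  along-a zero    _    = refl
  along-a (suc a) ≡t+1 = power-linear α β γ t a b c (ℕₚ.suc-injective ≡t+1)
  along-b : ∀ b → a ℕ.+ b ℕ.+ c ≡ suc t →
    shift (λ b′ → powPS (linPS α β γ) t a b′ c) b ≡ shift (λ b′ → multinomial α β γ t a b′ c) b
  along-b zero    _    = refl
  along-b (suc b) ≡t+1 = power-linear α β γ t a b c
    (ℕₚ.suc-injective (trans (cong (ℕ._+ c) (sym (ℕₚ.+-suc a b))) ≡t+1))
  along-c : ∀ c → a ℕ.+ b ℕ.+ c ≡ suc t →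
    shift (λ c′ → powPS (linPS α β γ) t a b c′) c ≡ shift (λ c′ → multinomial α β γ t a b c′) c
  along-c zero    _    = refl
  along-c (suc c) ≡t+1 = power-linear α β γ t a b c
    (ℕₚ.suc-injective (trans (sym (ℕₚ.+-suc (a ℕ.+ b) c)) ≡t+1))

-- For u = αx + βy + γz only the term k = a + b + c of the sums defining
-- (1 + u)^ρ and 1/(1 − u) contributes to the coefficient of x^a y^b z^c.
binomSeries-linear : ∀ ρ α β γ a b c → let N = a ℕ.+ b ℕ.+ c in
  binomSeries ρ (linPS α β γ) a b c ≡ binomQ ρ N * multinomial α β γ N a b c
binomSeries-linear ρ α β γ a b c = trans
  (sumTo-last N _ (λ k k<N → trans (cong (binomQ ρ k *_) (power-linear-off-degree α β γ k a b c (ℕₚ.>⇒≢ k<N)))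
                                   (*-zeroʳ (binomQ ρ k))))
  (cong (binomQ ρ N *_) (power-linear α β γ N a b c refl))
  where N = a ℕ.+ b ℕ.+ c

geomSeries-linear : ∀ α β γ a b c → let N = a ℕ.+ b ℕ.+ c in
  geomSeries (linPS α β γ) a b c ≡ multinomial α β γ N a b c
geomSeries-linear α β γ a b c =
  trans (sumTo-last N _ (λ k k<N → power-linear-off-degree α β γ k a b c (ℕₚ.>⇒≢ k<N)))
        (power-linear α β γ N a b c refl)
  where N = a ℕ.+ b ℕ.+ c

numerator : PS3
numerator = binomSeries ⅔ (linPS (- 1ℚ) (- fromℕ 2) 0ℚ)

denominator : PS3
denominator = geomSeries (linPS 1ℚ 1ℚ 1ℚ)

-- [x^i y^j] (1 − x − 2y)^{2/3} = (−2/3)_{i+j} 2^j / (i! j!), since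
-- binom(2/3, n)·n!·(−1)^n = (−2/3)_n.
numerator-coeff : ∀ i j → numerator i j 0 ≡ poch (- ⅔) (j ℕ.+ i) * fromℕ 2 ^ j * invFact i * invFact j
numerator-coeff i j = begin
  numerator i j 0
    ≡⟨ binomSeries-linear ⅔ (- 1ℚ) (- fromℕ 2) 0ℚ i j 0 ⟩
  fallingQ ⅔ N * invFact N * (factQ N * invFact i * invFact j * invFact 0 * ((- 1ℚ) ^ i * (- fromℕ 2) ^ j * 1ℚ))
    ≡⟨ regroup (fallingQ ⅔ N) (invFact N) (factQ N) (invFact i) (invFact j) ((- 1ℚ) ^ i) ((- 1ℚ) ^ j) (fromℕ 2 ^ j)
               refl (^-* (- 1ℚ) (fromℕ 2) j) ⟩
  fallingQ ⅔ N * ((- 1ℚ) ^ i * (- 1ℚ) ^ j) * (factQ N * invFact N) * (fromℕ 2 ^ j * invFact i * invFact j)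
    ≡⟨ cong₂ (λ s u → fallingQ ⅔ N * s * u * (fromℕ 2 ^ j * invFact i * invFact j)) signs (fact-invFact N) ⟩
  fallingQ ⅔ N * (- 1ℚ) ^ N * 1ℚ * (fromℕ 2 ^ j * invFact i * invFact j)
    ≡⟨ cong (λ P → P * 1ℚ * (fromℕ 2 ^ j * invFact i * invFact j)) (falling-sign ⅔ N) ⟩
  poch (- ⅔) N * 1ℚ * (fromℕ 2 ^ j * invFact i * invFact j)
    ≡⟨ cong (λ n → poch (- ⅔) n * 1ℚ * (fromℕ 2 ^ j * invFact i * invFact j)) N≡j+i ⟩
  poch (- ⅔) (j ℕ.+ i) * 1ℚ * (fromℕ 2 ^ j * invFact i * invFact j)
    ≡⟨ tidy (poch (- ⅔) (j ℕ.+ i)) (fromℕ 2 ^ j) (invFact i) (invFact j) ⟩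
  poch (- ⅔) (j ℕ.+ i) * fromℕ 2 ^ j * invFact i * invFact j ∎
  where
  open ≡-Reasoning
  N = i ℕ.+ j ℕ.+ 0
  N≡j+i : N ≡ j ℕ.+ i
  N≡j+i = trans (ℕₚ.+-identityʳ (i ℕ.+ j)) (ℕₚ.+-comm i j)
  signs : (- 1ℚ) ^ i * (- 1ℚ) ^ j ≡ (- 1ℚ) ^ N
  signs = trans (sym (^-+ (- 1ℚ) i j)) (cong ((- 1ℚ) ^_) (sym (ℕₚ.+-identityʳ (i ℕ.+ j))))
  regroup : ∀ F IN FN I J Sᵢ Sⱼ W {I₀ T} → I₀ ≡ 1ℚ → T ≡ Sⱼ * W →
    F * IN * (FN * I * J * I₀ * (Sᵢ * T * 1ℚ)) ≡ F * (Sᵢ * Sⱼ) * (FN * IN) * (W * I * J)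
  regroup F IN FN I J Sᵢ Sⱼ W refl refl = solve (F ∷ IN ∷ FN ∷ I ∷ J ∷ Sᵢ ∷ Sⱼ ∷ W ∷ []) ℚ-ring
  tidy : ∀ P W I J → P * 1ℚ * (W * I * J) ≡ P * W * I * J
  tidy = solve-∀ ℚ-ring

numerator-z : ∀ i j k → numerator i j (suc k) ≡ 0ℚ
numerator-z i j k = trans (binomSeries-linear ⅔ (- 1ℚ) (- fromℕ 2) 0ℚ i j (suc k))
  (annihilate (binomQ ⅔ N) (factQ N * invFact i * invFact j * invFact (suc k))
              ((- 1ℚ) ^ i) ((- fromℕ 2) ^ j) (0ℚ ^ k))
  where
  N = i ℕ.+ j ℕ.+ suc k
  annihilate : ∀ B F X Y Z → B * (F * (X * Y * (0ℚ * Z))) ≡ 0ℚ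
  annihilate = solve-∀ ℚ-ring

denominator-coeff : ∀ a b c → denominator a b c ≡ factQ (a ℕ.+ b ℕ.+ c) * invFact a * invFact b * invFact c
denominator-coeff a b c = begin
  denominator a b c
    ≡⟨ geomSeries-linear 1ℚ 1ℚ 1ℚ a b c ⟩
  factQ (a ℕ.+ b ℕ.+ c) * invFact a * invFact b * invFact c * (1ℚ ^ a * 1ℚ ^ b * 1ℚ ^ c)
    ≡⟨ cong (factQ (a ℕ.+ b ℕ.+ c) * invFact a * invFact b * invFact c *_)
            (cong₂ _*_ (cong₂ _*_ (1^ a) (1^ b)) (1^ c)) ⟩
  factQ (a ℕ.+ b ℕ.+ c) * invFact a * invFact b * invFact c * 1ℚ
    ≡⟨ *-identityʳ _ ⟩
  factQ (a ℕ.+ b ℕ.+ c) * invFact a * invFact b * invFact c ∎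
  where open ≡-Reasoning

diagonal-term : ∀ i j k → let m = j ℕ.+ k in
  numerator i j 0 * denominator (m ∸ i) k m
  ≡ outer-term j k * invFact m * vandermonde-term (- ⅔ + fromℕ j) (1ℚ + fromℕ (j ℕ.+ k ℕ.+ k)) i (m ∸ i)
diagonal-term i j k = begin
  numerator i j 0 * denominator l k m
    ≡⟨ cong₂ _*_ (numerator-coeff i j) (denominator-coeff l k m) ⟩
  poch (- ⅔) (j ℕ.+ i) * W * invFact i * invFact j * (factQ (l ℕ.+ k ℕ.+ m) * invFact l * invFact k * invFact m)
    ≡⟨ cong₂ (λ P F → P * W * invFact i * invFact j * (F * invFact l * invFact k * invFact m))
             (poch-+ (- ⅔) j i) (trans (cong factQ (reorder l k j)) (fact-+ (j ℕ.+ k ℕ.+ k) l)) ⟩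
  poch (- ⅔) j * poch (- ⅔ + fromℕ j) i * W * invFact i * invFact j
    * (factQ (j ℕ.+ k ℕ.+ k) * poch (1ℚ + fromℕ (j ℕ.+ k ℕ.+ k)) l * invFact l * invFact k * invFact m)
    ≡⟨ separate (poch (- ⅔) j) (poch (- ⅔ + fromℕ j) i) W (invFact i) (invFact j)
                (factQ (j ℕ.+ k ℕ.+ k)) (poch (1ℚ + fromℕ (j ℕ.+ k ℕ.+ k)) l) (invFact l) (invFact k) (invFact m) ⟩
  poch (- ⅔) j * W * invFact j * invFact k * factQ (j ℕ.+ k ℕ.+ k) * invFact m
    * (poch (- ⅔ + fromℕ j) i * poch (1ℚ + fromℕ (j ℕ.+ k ℕ.+ k)) l * invFact i * invFact l) ∎
  where
  open ≡-Reasoning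
  m = j ℕ.+ k
  l = m ∸ i
  W = fromℕ 2 ^ j
  reorder : ∀ l k j → l ℕ.+ k ℕ.+ (j ℕ.+ k) ≡ j ℕ.+ k ℕ.+ k ℕ.+ l
  reorder = ℕ-Solver.solve-∀
  separate : ∀ P Q W Iᵢ Iⱼ F R Iₗ Iₖ Iₘ →
    P * Q * W * Iᵢ * Iⱼ * (F * R * Iₗ * Iₖ * Iₘ) ≡ P * W * Iⱼ * Iₖ * F * Iₘ * (Q * R * Iᵢ * Iₗ)
  separate = solve-∀ ℚ-ring

-- For fixed j ≤ m the sum over i is a Chu–Vandermonde sum, with
-- (−2/3 + j) + (1 + 2m − j) = 1/3 + 2m.
inner-sum : ∀ m j → j ≤ m →
  sumTo m (λ i → numerator i j 0 * denominator (m ∸ i) (m ∸ j) m)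
  ≡ outer-term j (m ∸ j) * (invFact m * (poch (⅓ + fromℕ (m ℕ.+ m)) m * invFact m))
inner-sum m j j≤m with ℕₚ.m≤n⇒∃[o]m+o≡n j≤m
... | k , refl rewrite ℕₚ.m+n∸m≡n j k = begin
  sumTo m (λ i → numerator i j 0 * denominator (m ∸ i) k m)
    ≡⟨ sumTo-cong m (λ i → diagonal-term i j k) ⟩
  sumTo m (λ i → Z * invFact m * vandermonde-term A B i (m ∸ i))
    ≡⟨ sumTo-*ˡ m (Z * invFact m) (λ i → vandermonde-term A B i (m ∸ i)) ⟩
  Z * invFact m * antidiagonal (vandermonde-term A B) m
    ≡⟨ cong (Z * invFact m *_) (vandermonde A B m) ⟩
  Z * invFact m * (poch (A + B) m * invFact m)
    ≡⟨ cong (λ c → Z * invFact m * (poch c m * invFact m)) A+B ⟩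
  Z * invFact m * (poch (⅓ + fromℕ (m ℕ.+ m)) m * invFact m)
    ≡⟨ *-assoc Z (invFact m) _ ⟩
  Z * (invFact m * (poch (⅓ + fromℕ (m ℕ.+ m)) m * invFact m)) ∎
  where
  open ≡-Reasoning
  Z = outer-term j k
  A = - ⅔ + fromℕ j
  B = 1ℚ + fromℕ (j ℕ.+ k ℕ.+ k)
  parameters : ∀ a b {N M} → N ≡ a + b + b → M ≡ (a + b) + (a + b) → - ⅔ + a + (1ℚ + N) ≡ ⅓ + M
  parameters a b refl refl = solve (a ∷ b ∷ []) ℚ-ring
  A+B : A + B ≡ ⅓ + fromℕ (m ℕ.+ m)
  A+B = parameters (fromℕ j) (fromℕ k)
    (trans (fromℕ-+ (j ℕ.+ k) k) (cong (_+ fromℕ k) (fromℕ-+ j k)))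
    (trans (fromℕ-+ m m) (cong₂ _+_ (fromℕ-+ j k) (fromℕ-+ j k)))

-- The diagonal coefficient reduces to the outer sum: Diag(f)_m = E_m (1/3 + 2m)_m / (m!)².
-- The numerator has no z, so only k = 0 survives; then sum over i first.
diagonal-coeff : ∀ m →
  Diag fSeries m ≡ antidiagonal outer-term m * (invFact m * (poch (⅓ + fromℕ (m ℕ.+ m)) m * invFact m))
diagonal-coeff m = begin
  sumTo m (λ i → sumTo m (λ j → sumTo m (λ k → numerator i j k * denominator (m ∸ i) (m ∸ j) (m ∸ k))))
    ≡⟨ sumTo-cong m (λ i → sumTo-cong m (λ j → sumTo-first m _ (λ k → z-free i j k))) ⟩
  sumTo m (λ i → sumTo m (λ j → numerator i j 0 * denominator (m ∸ i) (m ∸ j) m))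
    ≡⟨ sumTo-swap m m _ ⟩
  sumTo m (λ j → sumTo m (λ i → numerator i j 0 * denominator (m ∸ i) (m ∸ j) m))
    ≡⟨ sumTo-cong≤ m (inner-sum m) ⟩
  sumTo m (λ j → outer-term j (m ∸ j) * C)
    ≡⟨ sumTo-*ʳ m C (λ j → outer-term j (m ∸ j)) ⟩
  antidiagonal outer-term m * C ∎
  where
  open ≡-Reasoning
  C = invFact m * (poch (⅓ + fromℕ (m ℕ.+ m)) m * invFact m)
  z-free : ∀ i j k → numerator i j (suc k) * denominator (m ∸ i) (m ∸ j) (m ∸ suc k) ≡ 0ℚ
  z-free i j k = trans (cong (_* denominator (m ∸ i) (m ∸ j) (m ∸ suc k)) (numerator-z i j k))
                       (*-zeroˡ (denominator (m ∸ i) (m ∸ j) (m ∸ suc k)))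

-- (1/3)_{3m} = 27^m (1/9)_m (4/9)_m (7/9)_m: triplication at x = 1/9.
third-triplication : ∀ m →
  poch ⅓ (m ℕ.+ m ℕ.+ m) ≡ prodPoch ((+ 1) / 9 ∷ (+ 4) / 9 ∷ (+ 7) / 9 ∷ []) m * fromℕ 27 ^ m
third-triplication m = begin
  poch ⅓ (m ℕ.+ m ℕ.+ m)
    ≡⟨ poch-triplication ((+ 1) / 9) m ⟩
  poch ((+ 1) / 9) m * poch ((+ 4) / 9) m * poch ((+ 7) / 9) m * fromℕ 27 ^ m
    ≡⟨ regroup (poch ((+ 1) / 9) m) (poch ((+ 4) / 9) m) (poch ((+ 7) / 9) m) (fromℕ 27 ^ m) ⟩
  poch ((+ 1) / 9) m * (poch ((+ 4) / 9) m * (poch ((+ 7) / 9) m * 1ℚ)) * fromℕ 27 ^ m ∎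
  where
  open ≡-Reasoning
  regroup : ∀ a b c w → a * b * c * w ≡ a * (b * (c * 1ℚ)) * w
  regroup = solve-∀ ℚ-ring

diagonal-cleared : ∀ m →
  Diag fSeries m * (prodPoch (⅔ ∷ 1ℚ ∷ []) m * factQ m) ≡ poch ⅓ (m ℕ.+ m ℕ.+ m)
diagonal-cleared m = begin
  Diag fSeries m * (poch ⅔ m * (poch 1ℚ m * 1ℚ) * factQ m)
    ≡⟨ cong₂ (λ d p → d * (poch ⅔ m * (p * 1ℚ) * factQ m)) (diagonal-coeff m) (poch-one m) ⟩
  E * (invFact m * (Q * invFact m)) * (poch ⅔ m * (factQ m * 1ℚ) * factQ m)
    ≡⟨ regroup E (invFact m) Q (poch ⅔ m) (factQ m) ⟩
  E * poch ⅔ m * Q * (factQ m * invFact m) * (factQ m * invFact m)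
    ≡⟨ cong₂ (λ s u → s * Q * u * u) (outer-sum m) (fact-invFact m) ⟩
  poch ⅓ (m ℕ.+ m) * Q * 1ℚ * 1ℚ
    ≡⟨ trans (*-identityʳ _) (*-identityʳ _) ⟩
  poch ⅓ (m ℕ.+ m) * Q
    ≡⟨ sym (poch-+ ⅓ (m ℕ.+ m) m) ⟩
  poch ⅓ (m ℕ.+ m ℕ.+ m) ∎
  where
  open ≡-Reasoning
  E = antidiagonal outer-term m
  Q = poch (⅓ + fromℕ (m ℕ.+ m)) m
  regroup : ∀ E I Q P F → E * (I * (Q * I)) * (P * (F * 1ℚ) * F) ≡ E * P * Q * (F * I) * (F * I)
  regroup = solve-∀ ℚ-ring

mainTheorem4 : (n : ℕ) →
    Diag fSeries n
      ≡ hypergeomCoeff ((+ 1) / 9 ∷ (+ 4) / 9 ∷ (+ 7) / 9 ∷ [])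
                       ((+ 2) / 3 ∷ 1ℚ ∷ [])
                       (fromℕ 27) n
mainTheorem4 m = begin
  Diag fSeries m
    ≡⟨ solve-for (Diag fSeries m) (poch ⅓ (m ℕ.+ m ℕ.+ m)) D {{D-pos}} (diagonal-cleared m) ⟩
  poch ⅓ (m ℕ.+ m ℕ.+ m) * inv D
    ≡⟨ cong (_* inv D) (third-triplication m) ⟩
  prodPoch as m * fromℕ 27 ^ m * inv D
    ≡⟨ swap (prodPoch as m) (fromℕ 27 ^ m) (inv D) ⟩
  hypergeomCoeff as (⅔ ∷ 1ℚ ∷ []) (fromℕ 27) m ∎
  where
  open ≡-Reasoning
  as = (+ 1) / 9 ∷ (+ 4) / 9 ∷ (+ 7) / 9 ∷ []
  D = prodPoch (⅔ ∷ 1ℚ ∷ []) m * factQ m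
  D-pos : Positive D
  D-pos = pos*pos⇒pos (poch ⅔ m * (poch 1ℚ m * 1ℚ)) {{lower-pos}} (factQ m) {{factQ-pos m}}
    where
    lower-pos : Positive (poch ⅔ m * (poch 1ℚ m * 1ℚ))
    lower-pos = pos*pos⇒pos (poch ⅔ m) {{poch-pos ⅔ m}} (poch 1ℚ m * 1ℚ)
                  {{pos*pos⇒pos (poch 1ℚ m) {{poch-pos 1ℚ m}} 1ℚ}}
  swap : ∀ a b c → a * b * c ≡ a * c * b
  swap = solve-∀ ℚ-ring
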